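{- If $t \equiv u$ and $A \sim B$ then $(t/x)A \sim (u/x)B$.
   Context: Deduction modulo: a theory $\mathcal{T}, \equiv$ is given by axioms $\mathcal{T}$ and a congruence $\equiv$ on terms and formulae generated by a confluent rewrite system rewriting terms to terms and atomic formulae to formulae. Let $\mathcal{L}$ be the language, $S$ an infinite set of fresh constants, and $\mathcal{L}' = \mathcal{L}\cup S$. The relation $\sim$ on formulae of $\mathcal{L}'$ is the smallest congruence such that: if $A\equiv B$ then $A\sim B$; if $A\sim B$ and $A'\sim B'$ then $(A\wedge A')\sim(B\wedge B')$, $(A\vee A')\sim(B\vee B')$ and $(A\Rightarrow A')\sim(B\Rightarrow B')$; and if for each term $t$ there is a term $u$ with $(t/x)A\sim(u/x)B$ and for each term $u$ there is a term $t$ with $(u/x)B\sim(t/x)A$, then $\forall x\,A\sim\forall x\,B$ and $\exists x\,A\sim\exists x\,B$. -}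

module Defs where

open import Data.Nat using (ℕ; zero; suc; _≟_)
open import Data.Empty using (⊥; ⊥-elim)
open import Data.Vec using (Vec; []; _∷_)
open import Data.Product using (Σ; ∃; _×_; _,_)
open import Relation.Nullary using (does)
open import Data.Bool using (if_then_else_)
open import Relation.Binary.PropositionalEquality using (_≡_)
open import Relation.Binary.Construct.Closure.ReflexiveTransitive using (Star)
open import Relation.Binary.Construct.Closure.Equivalence using (EqClosure)

record Signature : Set₁ where
  field
    Fun       : Set
    funArity  : Fun → ℕ
    Pred      : Set
    predArity : Pred → ℕ
open Signature public

-- Terms and formulae with de Bruijn variables, over the language extended
-- by a set C of extra constants.  L-terms: C = ⊥.  L'-terms: C = ℕ (the
-- infinite set S of fresh constants).
module _ (Sg : Signature) where

  data Term (C : Set) : Set where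
    var : ℕ → Term C
    cst : C → Term C
    app : (f : Fun Sg) → Vec (Term C) (funArity Sg f) → Term C

  data Formula (C : Set) : Set where
    atom : (P : Pred Sg) → Vec (Term C) (predArity Sg P) → Formula C
    ⊤̇ ⊥̇ : Formula C
    _∧̇_ _∨̇_ _⇒̇_ : Formula C → Formula C → Formula C
    ∀̇ ∃̇ : Formula C → Formula C   -- binds de Bruijn variable 0

module _ {Sg : Signature} where

  mutual
    embT : {C : Set} → Term Sg ⊥ → Term Sg C
    embT (var n) = var n
    embT (cst ())
    embT (app f ts) = app f (embV ts)

    embV : {C : Set} {n : ℕ} → Vec (Term Sg ⊥) n → Vec (Term Sg C) n
    embV [] = []
    embV (t ∷ ts) = embT t ∷ embV ts

  embF : {C : Set} → Formula Sg ⊥ → Formula Sg C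
  embF (atom P ts) = atom P (embV ts)
  embF ⊤̇ = ⊤̇
  embF ⊥̇ = ⊥̇
  embF (A ∧̇ B) = embF A ∧̇ embF B
  embF (A ∨̇ B) = embF A ∨̇ embF B
  embF (A ⇒̇ B) = embF A ⇒̇ embF B
  embF (∀̇ A) = ∀̇ (embF A)
  embF (∃̇ A) = ∃̇ (embF A)

  mutual
    tsub : {C : Set} → (ℕ → Term Sg C) → Term Sg C → Term Sg C
    tsub σ (var n) = σ n
    tsub σ (cst c) = cst c
    tsub σ (app f ts) = app f (vsub σ ts)

    vsub : {C : Set} {n : ℕ} → (ℕ → Term Sg C) → Vec (Term Sg C) n → Vec (Term Sg C) n
    vsub σ [] = []
    vsub σ (t ∷ ts) = tsub σ t ∷ vsub σ ts

  lift : {C : Set} → (ℕ → Term Sg C) → ℕ → Term Sg C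
  lift σ zero = var zero
  lift σ (suc n) = tsub (λ m → var (suc m)) (σ n)

  fsub : {C : Set} → (ℕ → Term Sg C) → Formula Sg C → Formula Sg C
  fsub σ (atom P ts) = atom P (vsub σ ts)
  fsub σ ⊤̇ = ⊤̇
  fsub σ ⊥̇ = ⊥̇
  fsub σ (A ∧̇ B) = fsub σ A ∧̇ fsub σ B
  fsub σ (A ∨̇ B) = fsub σ A ∨̇ fsub σ B
  fsub σ (A ⇒̇ B) = fsub σ A ⇒̇ fsub σ B
  fsub σ (∀̇ A) = ∀̇ (fsub (lift σ) A)
  fsub σ (∃̇ A) = ∃̇ (fsub (lift σ) A)

  single : {C : Set} → ℕ → Term Sg C → ℕ → Term Sg C
  single x t y = if does (y ≟ x) then t else var y

  _/_∙_ : {C : Set} → Term Sg C → ℕ → Formula Sg C → Formula Sg C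
  t / x ∙ A = fsub (single x t) A

  -- instantiating the bound variable of a quantifier body by t, i.e. (t/x)A
  -- for ∀x A written ∀̇ A in de Bruijn notation
  inst0 : {C : Set} → Term Sg C → ℕ → Term Sg C
  inst0 t zero = t
  inst0 t (suc n) = var n

  _[_] : {C : Set} → Formula Sg C → Term Sg C → Formula Sg C
  A [ t ] = fsub (inst0 t) A

  mutual
    OccT : {C : Set} → ℕ → Term Sg C → Set
    OccT n (var m) = n ≡ m
    OccT n (cst c) = ⊥
    OccT n (app f ts) = OccV n ts

    OccV : {C : Set} {k : ℕ} → ℕ → Vec (Term Sg C) k → Set
    OccV n [] = ⊥
    OccV n (t ∷ ts) = Data.Sum._⊎_ (OccT n t) (OccV n ts)
      where import Data.Sum

  OccF : {C : Set} → ℕ → Formula Sg C → Set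
  OccF n (atom P ts) = OccV n ts
  OccF n ⊤̇ = ⊥
  OccF n ⊥̇ = ⊥
  OccF n (A ∧̇ B) = Data.Sum._⊎_ (OccF n A) (OccF n B) where import Data.Sum
  OccF n (A ∨̇ B) = Data.Sum._⊎_ (OccF n A) (OccF n B) where import Data.Sum
  OccF n (A ⇒̇ B) = Data.Sum._⊎_ (OccF n A) (OccF n B) where import Data.Sum
  OccF n (∀̇ A) = OccF (suc n) A
  OccF n (∃̇ A) = OccF (suc n) A

record RewriteSystem (Sg : Signature) : Set₁ where
  field
    TRule : Term Sg ⊥ → Term Sg ⊥ → Set
    PRule : (P : Pred Sg) → Vec (Term Sg ⊥) (predArity Sg P) → Formula Sg ⊥ → Set
    TRule-vars : ∀ {l r} → TRule l r → ∀ n → OccT n r → OccT n l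
    PRule-vars : ∀ {P ts A} → PRule P ts A → ∀ n → OccF n A → OccV n ts
open RewriteSystem public

Term' : Signature → Set
Term' Sg = Term Sg ℕ

Formula' : Signature → Set
Formula' Sg = Formula Sg ℕ

module _ {Sg : Signature} (R : RewriteSystem Sg) where

  mutual
    data _⟶t_ : Term' Sg → Term' Sg → Set where
      rule : ∀ {l r} → TRule R l r → (σ : ℕ → Term' Sg) →
             tsub σ (embT l) ⟶t tsub σ (embT r)
      arg  : ∀ {f ts ts'} → _⟶v_ ts ts' → app f ts ⟶t app f ts'

    data _⟶v_ : {k : ℕ} → Vec (Term' Sg) k → Vec (Term' Sg) k → Set where
      here  : ∀ {k t t'} {ts : Vec (Term' Sg) k} → t ⟶t t' → (t ∷ ts) ⟶v (t' ∷ ts)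
      there : ∀ {k t} {ts ts' : Vec (Term' Sg) k} → ts ⟶v ts' → (t ∷ ts) ⟶v (t ∷ ts')

  data _⟶f_ : Formula' Sg → Formula' Sg → Set where
    rule : ∀ {P ts A} → PRule R P ts A → (σ : ℕ → Term' Sg) →
           atom P (vsub σ (embV ts)) ⟶f fsub σ (embF A)
    atomArg : ∀ {P ts ts'} → ts ⟶v ts' → atom P ts ⟶f atom P ts'
    ∧l : ∀ {A A' B} → A ⟶f A' → (A ∧̇ B) ⟶f (A' ∧̇ B)
    ∧r : ∀ {A B B'} → B ⟶f B' → (A ∧̇ B) ⟶f (A ∧̇ B')
    ∨l : ∀ {A A' B} → A ⟶f A' → (A ∨̇ B) ⟶f (A' ∨̇ B)
    ∨r : ∀ {A B B'} → B ⟶f B' → (A ∨̇ B) ⟶f (A ∨̇ B')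
    ⇒l : ∀ {A A' B} → A ⟶f A' → (A ⇒̇ B) ⟶f (A' ⇒̇ B)
    ⇒r : ∀ {A B B'} → B ⟶f B' → (A ⇒̇ B) ⟶f (A ⇒̇ B')
    ∀c : ∀ {A A'} → A ⟶f A' → ∀̇ A ⟶f ∀̇ A'
    ∃c : ∀ {A A'} → A ⟶f A' → ∃̇ A ⟶f ∃̇ A'

  Confluent : Set
  Confluent =
    (∀ {a b c} → Star _⟶t_ a b → Star _⟶t_ a c →
       ∃ λ d → Star _⟶t_ b d × Star _⟶t_ c d) ×
    (∀ {A B C} → Star _⟶f_ A B → Star _⟶f_ A C →
       ∃ λ D → Star _⟶f_ B D × Star _⟶f_ C D)

  _≡t_ : Term' Sg → Term' Sg → Set
  _≡t_ = EqClosure _⟶t_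

  _≡f_ : Formula' Sg → Formula' Sg → Set
  _≡f_ = EqClosure _⟶f_

  data _∼_ : Formula' Sg → Formula' Sg → Set where
    ≡⇒∼   : ∀ {A B} → A ≡f B → A ∼ B
    ∼refl : ∀ {A} → A ∼ A
    ∼sym  : ∀ {A B} → A ∼ B → B ∼ A
    ∼trans : ∀ {A B C} → A ∼ B → B ∼ C → A ∼ C
    ∧∼ : ∀ {A A' B B'} → A ∼ B → A' ∼ B' → (A ∧̇ A') ∼ (B ∧̇ B')
    ∨∼ : ∀ {A A' B B'} → A ∼ B → A' ∼ B' → (A ∨̇ A') ∼ (B ∨̇ B')
    ⇒∼ : ∀ {A A' B B'} → A ∼ B → A' ∼ B' → (A ⇒̇ A') ∼ (B ⇒̇ B')
    ∀∼ : ∀ {A B} →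
         (∀ t → ∃ λ u → (A [ t ]) ∼ (B [ u ])) →
         (∀ u → ∃ λ t → (B [ u ]) ∼ (A [ t ])) →
         ∀̇ A ∼ ∀̇ B
    ∃∼ : ∀ {A B} →
         (∀ t → ∃ λ u → (A [ t ]) ∼ (B [ u ])) →
         (∀ u → ∃ λ t → (B [ u ]) ∼ (A [ t ])) →
         ∃̇ A ∼ ∃̇ B

-- The relation ∼ is stable under every substitution σ.  The only interesting
-- case is a quantifier: to match an instance (lift σ A)[t], instantiate the
-- hypothesis at a variable k beyond all free variables of A and B, obtaining
-- A[k] ∼ B[u], and then substitute t for k and σ elsewhere.  Independently,
-- substituting ≡-equal terms yields ≡-equal formulae, so
-- (t/x)A ∼ (t/x)B ≡ (u/x)B.
{-# OPTIONS --safe #-}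
module Submission where

open import Defs
open import Data.Nat using (ℕ; zero; suc; _<_; _≤_; _⊔_; pred; _≟_; s≤s)
open import Data.Nat.Properties
  using (m<n⇒m<n⊔o; m<n⇒m<o⊔n; m≤m⊔n; m≤n⊔m; <-≤-trans; <⇒≢; n<1+n; <-trans)
open import Data.Vec using (Vec; []; _∷_)
open import Data.Product using (∃; _,_; proj₁; proj₂)
open import Data.Bool using (true; false)
open import Data.Empty using (⊥-elim)
open import Function using (_∘_)
open import Relation.Nullary using (does; yes; no)
open import Relation.Binary.PropositionalEquality
  using (_≡_; refl; sym; trans; cong; cong₂; subst₂; module ≡-Reasoning)
open import Relation.Binary.Construct.Closure.ReflexiveTransitive using (ε; _◅◅_)
open import Relation.Binary.Construct.Closure.Equivalence using (EqClosure; gmap)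

module _ {Sg : Signature} {C : Set} where

  private
    Subst : Set
    Subst = ℕ → Term Sg C

  shift : Subst
  shift n = var (suc n)

  mutual
    tsub-∘ : (σ τ : Subst) (s : Term Sg C) → tsub σ (tsub τ s) ≡ tsub (tsub σ ∘ τ) s
    tsub-∘ σ τ (var n) = refl
    tsub-∘ σ τ (cst c) = refl
    tsub-∘ σ τ (app f ts) = cong (app f) (vsub-∘ σ τ ts)

    vsub-∘ : ∀ {k} (σ τ : Subst) (ts : Vec (Term Sg C) k) →
             vsub σ (vsub τ ts) ≡ vsub (tsub σ ∘ τ) ts
    vsub-∘ σ τ [] = refl
    vsub-∘ σ τ (t ∷ ts) = cong₂ _∷_ (tsub-∘ σ τ t) (vsub-∘ σ τ ts)

  mutual
    tsub-id : (s : Term Sg C) → tsub var s ≡ s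
    tsub-id (var n) = refl
    tsub-id (cst c) = refl
    tsub-id (app f ts) = cong (app f) (vsub-id ts)

    vsub-id : ∀ {k} (ts : Vec (Term Sg C) k) → vsub var ts ≡ ts
    vsub-id [] = refl
    vsub-id (t ∷ ts) = cong₂ _∷_ (tsub-id t) (vsub-id ts)

  mutual
    boundT : Term Sg C → ℕ
    boundT (var n) = suc n
    boundT (cst c) = 0
    boundT (app f ts) = boundV ts

    boundV : ∀ {k} → Vec (Term Sg C) k → ℕ
    boundV [] = 0
    boundV (t ∷ ts) = boundT t ⊔ boundV ts

  boundF : Formula Sg C → ℕ
  boundF (atom P ts) = boundV ts
  boundF ⊤̇ = 0
  boundF ⊥̇ = 0
  boundF (A ∧̇ B) = boundF A ⊔ boundF B
  boundF (A ∨̇ B) = boundF A ⊔ boundF B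
  boundF (A ⇒̇ B) = boundF A ⊔ boundF B
  boundF (∀̇ A) = pred (boundF A)
  boundF (∃̇ A) = pred (boundF A)

  AgreeBelow : ℕ → Subst → Subst → Set
  AgreeBelow b σ τ = ∀ {n} → n < b → σ n ≡ τ n

  agreeBelow-⊔ˡ : ∀ {a b σ τ} → AgreeBelow (a ⊔ b) σ τ → AgreeBelow a σ τ
  agreeBelow-⊔ˡ {b = b} h p = h (m<n⇒m<n⊔o b p)

  agreeBelow-⊔ʳ : ∀ {a b σ τ} → AgreeBelow (a ⊔ b) σ τ → AgreeBelow b σ τ
  agreeBelow-⊔ʳ {a = a} h p = h (m<n⇒m<o⊔n a p)

  agreeBelow-lift : ∀ {b σ τ} → AgreeBelow (pred b) σ τ → AgreeBelow b (lift σ) (lift τ)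
  agreeBelow-lift h {zero} p = refl
  agreeBelow-lift {suc b} h {suc n} (s≤s p) = cong (tsub shift) (h p)

  mutual
    tsub-agree : ∀ {σ τ} (s : Term Sg C) → AgreeBelow (boundT s) σ τ → tsub σ s ≡ tsub τ s
    tsub-agree (var n) h = h (n<1+n n)
    tsub-agree (cst c) h = refl
    tsub-agree (app f ts) h = cong (app f) (vsub-agree ts h)

    vsub-agree : ∀ {k σ τ} (ts : Vec (Term Sg C) k) → AgreeBelow (boundV ts) σ τ →
                 vsub σ ts ≡ vsub τ ts
    vsub-agree [] h = refl
    vsub-agree (t ∷ ts) h =
      cong₂ _∷_ (tsub-agree t (agreeBelow-⊔ˡ h)) (vsub-agree ts (agreeBelow-⊔ʳ h))

  fsub-agree : ∀ {σ τ} (A : Formula Sg C) → AgreeBelow (boundF A) σ τ → fsub σ A ≡ fsub τ A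
  fsub-agree (atom P ts) h = cong (atom P) (vsub-agree ts h)
  fsub-agree ⊤̇ h = refl
  fsub-agree ⊥̇ h = refl
  fsub-agree (A ∧̇ B) h = cong₂ _∧̇_ (fsub-agree A (agreeBelow-⊔ˡ h)) (fsub-agree B (agreeBelow-⊔ʳ h))
  fsub-agree (A ∨̇ B) h = cong₂ _∨̇_ (fsub-agree A (agreeBelow-⊔ˡ h)) (fsub-agree B (agreeBelow-⊔ʳ h))
  fsub-agree (A ⇒̇ B) h = cong₂ _⇒̇_ (fsub-agree A (agreeBelow-⊔ˡ h)) (fsub-agree B (agreeBelow-⊔ʳ h))
  fsub-agree (∀̇ A) h = cong ∀̇ (fsub-agree A (agreeBelow-lift h))
  fsub-agree (∃̇ A) h = cong ∃̇ (fsub-agree A (agreeBelow-lift h))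

  fsub-cong : ∀ {σ τ} (A : Formula Sg C) → (∀ n → σ n ≡ τ n) → fsub σ A ≡ fsub τ A
  fsub-cong A h = fsub-agree A (λ {n} _ → h n)

  lift-∘ : (σ τ : Subst) (n : ℕ) → tsub (lift σ) (lift τ n) ≡ lift (tsub σ ∘ τ) n
  lift-∘ σ τ zero = refl
  lift-∘ σ τ (suc n) = trans (tsub-∘ (lift σ) shift (τ n)) (sym (tsub-∘ shift σ (τ n)))

  fsub-∘ : (σ τ : Subst) (A : Formula Sg C) → fsub σ (fsub τ A) ≡ fsub (tsub σ ∘ τ) A
  fsub-∘ σ τ (atom P ts) = cong (atom P) (vsub-∘ σ τ ts)
  fsub-∘ σ τ ⊤̇ = refl
  fsub-∘ σ τ ⊥̇ = refl
  fsub-∘ σ τ (A ∧̇ B) = cong₂ _∧̇_ (fsub-∘ σ τ A) (fsub-∘ σ τ B)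
  fsub-∘ σ τ (A ∨̇ B) = cong₂ _∨̇_ (fsub-∘ σ τ A) (fsub-∘ σ τ B)
  fsub-∘ σ τ (A ⇒̇ B) = cong₂ _⇒̇_ (fsub-∘ σ τ A) (fsub-∘ σ τ B)
  fsub-∘ σ τ (∀̇ A) = cong ∀̇ (trans (fsub-∘ (lift σ) (lift τ) A) (fsub-cong A (lift-∘ σ τ)))
  fsub-∘ σ τ (∃̇ A) = cong ∃̇ (trans (fsub-∘ (lift σ) (lift τ) A) (fsub-cong A (lift-∘ σ τ)))

  update : ℕ → Term Sg C → Subst → Subst
  update k t σ n with n ≟ k
  ... | yes _ = t
  ... | no _ = σ n

  update-≡ : (k : ℕ) (t : Term Sg C) (σ : Subst) → update k t σ k ≡ t
  update-≡ k t σ with k ≟ k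
  ... | yes _ = refl
  ... | no k≢k = ⊥-elim (k≢k refl)

  update-< : ∀ {k n} (t : Term Sg C) (σ : Subst) → n < k → update k t σ n ≡ σ n
  update-< {k} {n} t σ n<k with n ≟ k
  ... | yes n≡k = ⊥-elim (<⇒≢ n<k n≡k)
  ... | no _ = refl

  update-inst : ∀ {k} (A : Formula Sg C) (t u : Term Sg C) (σ : Subst) → boundF A ≤ k →
                fsub (update k t σ) (A [ u ]) ≡ fsub (lift σ) A [ tsub (update k t σ) u ]
  update-inst {k} A t u σ A≤k = begin
    fsub ρ (fsub (inst0 u) A)            ≡⟨ fsub-∘ ρ (inst0 u) A ⟩
    fsub (tsub ρ ∘ inst0 u) A            ≡⟨ fsub-agree A agree ⟩
    fsub (tsub (inst0 ρu) ∘ lift σ) A    ≡⟨ fsub-∘ (inst0 ρu) (lift σ) A ⟨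
    fsub (inst0 ρu) (fsub (lift σ) A)    ∎
    where
    open ≡-Reasoning
    ρ = update k t σ
    ρu = tsub ρ u
    agree : AgreeBelow (boundF A) (tsub ρ ∘ inst0 u) (tsub (inst0 ρu) ∘ lift σ)
    agree {zero} _ = refl
    agree {suc n} p = trans (update-< t σ (<-≤-trans (<-trans (n<1+n n) p) A≤k))
                            (sym (trans (tsub-∘ (inst0 ρu) shift (σ n)) (tsub-id (σ n))))

  update-inst-fresh : ∀ {k} (A : Formula Sg C) (t : Term Sg C) (σ : Subst) → boundF A ≤ k →
                      fsub (update k t σ) (A [ var k ]) ≡ fsub (lift σ) A [ t ]
  update-inst-fresh {k} A t σ A≤k =
    trans (update-inst A t (var k) σ A≤k) (cong (fsub (lift σ) A [_]) (update-≡ k t σ))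

module _ {Sg : Signature} (R : RewriteSystem Sg) where

  private
    Subst : Set
    Subst = ℕ → Term' Sg

  mutual
    ⟶t-tsub : ∀ (ρ : Subst) {s s'} → _⟶t_ R s s' → _⟶t_ R (tsub ρ s) (tsub ρ s')
    ⟶t-tsub ρ (rule {l} {r} l→r σ) =
      subst₂ (_⟶t_ R) (sym (tsub-∘ ρ σ (embT l))) (sym (tsub-∘ ρ σ (embT r)))
        (rule l→r (tsub ρ ∘ σ))
    ⟶t-tsub ρ (arg p) = arg (⟶v-vsub ρ p)

    ⟶v-vsub : ∀ (ρ : Subst) {k} {ts ts' : Vec (Term' Sg) k} →
              _⟶v_ R ts ts' → _⟶v_ R (vsub ρ ts) (vsub ρ ts')
    ⟶v-vsub ρ (here p) = here (⟶t-tsub ρ p)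
    ⟶v-vsub ρ (there p) = there (⟶v-vsub ρ p)

  ⟶f-fsub : ∀ (ρ : Subst) {A B} → _⟶f_ R A B → _⟶f_ R (fsub ρ A) (fsub ρ B)
  ⟶f-fsub ρ (rule {P} {ts} {A} P→A σ) =
    subst₂ (_⟶f_ R) (cong (atom P) (sym (vsub-∘ ρ σ (embV ts)))) (sym (fsub-∘ ρ σ (embF A)))
      (rule P→A (tsub ρ ∘ σ))
  ⟶f-fsub ρ (atomArg p) = atomArg (⟶v-vsub ρ p)
  ⟶f-fsub ρ (∧l p) = ∧l (⟶f-fsub ρ p)
  ⟶f-fsub ρ (∧r p) = ∧r (⟶f-fsub ρ p)
  ⟶f-fsub ρ (∨l p) = ∨l (⟶f-fsub ρ p)
  ⟶f-fsub ρ (∨r p) = ∨r (⟶f-fsub ρ p)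
  ⟶f-fsub ρ (⇒l p) = ⇒l (⟶f-fsub ρ p)
  ⟶f-fsub ρ (⇒r p) = ⇒r (⟶f-fsub ρ p)
  ⟶f-fsub ρ (∀c p) = ∀c (⟶f-fsub (lift ρ) p)
  ⟶f-fsub ρ (∃c p) = ∃c (⟶f-fsub (lift ρ) p)

  ≡f-fsub : ∀ (ρ : Subst) {A B} → _≡f_ R A B → _≡f_ R (fsub ρ A) (fsub ρ B)
  ≡f-fsub ρ = gmap (fsub ρ) (⟶f-fsub ρ)

  Simulates : Formula' Sg → Formula' Sg → Set
  Simulates A B = ∀ t → ∃ λ u → _∼_ R (A [ t ]) (B [ u ])

  simulates-lift : ∀ {A B} (σ : Subst) →
                   (∀ t → ∃ λ u → ∀ ρ → _∼_ R (fsub ρ (A [ t ])) (fsub ρ (B [ u ]))) →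
                   Simulates (fsub (lift σ) A) (fsub (lift σ) B)
  simulates-lift {A} {B} σ h t =
    tsub ρ u , subst₂ (_∼_ R) (update-inst-fresh A t σ (m≤m⊔n (boundF A) (boundF B)))
                              (update-inst B t u σ (m≤n⊔m (boundF A) (boundF B)))
                              (proj₂ (h (var k)) ρ)
    where
    k = boundF A ⊔ boundF B
    ρ = update k t σ
    u = proj₁ (h (var k))

  ∼-fsub : ∀ {A B} → _∼_ R A B → ∀ (σ : Subst) → _∼_ R (fsub σ A) (fsub σ B)
  ∼-fsub (≡⇒∼ p) σ = ≡⇒∼ (≡f-fsub σ p)
  ∼-fsub ∼refl σ = ∼refl
  ∼-fsub (∼sym p) σ = ∼sym (∼-fsub p σ)
  ∼-fsub (∼trans p q) σ = ∼trans (∼-fsub p σ) (∼-fsub q σ)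
  ∼-fsub (∧∼ p q) σ = ∧∼ (∼-fsub p σ) (∼-fsub q σ)
  ∼-fsub (∨∼ p q) σ = ∨∼ (∼-fsub p σ) (∼-fsub q σ)
  ∼-fsub (⇒∼ p q) σ = ⇒∼ (∼-fsub p σ) (∼-fsub q σ)
  ∼-fsub (∀∼ h₁ h₂) σ =
    ∀∼ (simulates-lift σ λ t → proj₁ (h₁ t) , ∼-fsub (proj₂ (h₁ t)))
       (simulates-lift σ λ u → proj₁ (h₂ u) , ∼-fsub (proj₂ (h₂ u)))
  ∼-fsub (∃∼ h₁ h₂) σ =
    ∃∼ (simulates-lift σ λ t → proj₁ (h₁ t) , ∼-fsub (proj₂ (h₁ t)))
       (simulates-lift σ λ u → proj₁ (h₂ u) , ∼-fsub (proj₂ (h₂ u)))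

  _≡v_ : ∀ {k} → Vec (Term' Sg) k → Vec (Term' Sg) k → Set
  _≡v_ = EqClosure (_⟶v_ R)

  ∷-cong-≡v : ∀ {k t t'} {ts ts' : Vec (Term' Sg) k} →
              _≡t_ R t t' → ts ≡v ts' → (t ∷ ts) ≡v (t' ∷ ts')
  ∷-cong-≡v {t' = t'} {ts = ts} p q = gmap (_∷ ts) here p ◅◅ gmap (t' ∷_) there q

  ≡f-cong₂ : (_⊙_ : Formula' Sg → Formula' Sg → Formula' Sg) →
             (∀ {A A' B} → _⟶f_ R A A' → _⟶f_ R (A ⊙ B) (A' ⊙ B)) →
             (∀ {A B B'} → _⟶f_ R B B' → _⟶f_ R (A ⊙ B) (A ⊙ B')) →
             ∀ {A A' B B'} → _≡f_ R A A' → _≡f_ R B B' → _≡f_ R (A ⊙ B) (A' ⊙ B')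
  ≡f-cong₂ _⊙_ left right {A' = A'} {B = B} p q = gmap (_⊙ B) left p ◅◅ gmap (A' ⊙_) right q

  PointwiseEquiv : Subst → Subst → Set
  PointwiseEquiv σ τ = ∀ n → _≡t_ R (σ n) (τ n)

  mutual
    tsub-cong-≡t : ∀ {σ τ} → PointwiseEquiv σ τ → ∀ s → _≡t_ R (tsub σ s) (tsub τ s)
    tsub-cong-≡t h (var n) = h n
    tsub-cong-≡t h (cst c) = ε
    tsub-cong-≡t h (app f ts) = gmap (app f) arg (vsub-cong-≡v h ts)

    vsub-cong-≡v : ∀ {σ τ} → PointwiseEquiv σ τ → ∀ {k} (ts : Vec (Term' Sg) k) →
                   vsub σ ts ≡v vsub τ ts
    vsub-cong-≡v h [] = ε
    vsub-cong-≡v h (t ∷ ts) = ∷-cong-≡v (tsub-cong-≡t h t) (vsub-cong-≡v h ts)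

  lift-cong-≡t : ∀ {σ τ} → PointwiseEquiv σ τ → PointwiseEquiv (lift σ) (lift τ)
  lift-cong-≡t h zero = ε
  lift-cong-≡t h (suc n) = gmap (tsub shift) (⟶t-tsub shift) (h n)

  fsub-cong-≡f : ∀ {σ τ} → PointwiseEquiv σ τ → ∀ A → _≡f_ R (fsub σ A) (fsub τ A)
  fsub-cong-≡f h (atom P ts) = gmap (atom P) atomArg (vsub-cong-≡v h ts)
  fsub-cong-≡f h ⊤̇ = ε
  fsub-cong-≡f h ⊥̇ = ε
  fsub-cong-≡f h (A ∧̇ B) = ≡f-cong₂ _∧̇_ ∧l ∧r (fsub-cong-≡f h A) (fsub-cong-≡f h B)
  fsub-cong-≡f h (A ∨̇ B) = ≡f-cong₂ _∨̇_ ∨l ∨r (fsub-cong-≡f h A) (fsub-cong-≡f h B)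
  fsub-cong-≡f h (A ⇒̇ B) = ≡f-cong₂ _⇒̇_ ⇒l ⇒r (fsub-cong-≡f h A) (fsub-cong-≡f h B)
  fsub-cong-≡f h (∀̇ A) = gmap ∀̇ ∀c (fsub-cong-≡f (lift-cong-≡t h) A)
  fsub-cong-≡f h (∃̇ A) = gmap ∃̇ ∃c (fsub-cong-≡f (lift-cong-≡t h) A)

  single-cong-≡t : ∀ x {t u} → _≡t_ R t u → PointwiseEquiv (single x t) (single x u)
  single-cong-≡t x t≡u n with does (n ≟ x)
  ... | true = t≡u
  ... | false = ε

mainTheorem11 : (Sg : Signature) (R : RewriteSystem Sg) → Confluent R →
    ∀ (t u : Term' Sg) (x : ℕ) (A B : Formula' Sg) →
    _≡t_ R t u → _∼_ R A B → _∼_ R (t / x ∙ A) (u / x ∙ B)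
mainTheorem11 Sg R _ t u x A B t≡u A∼B =
  ∼trans (∼-fsub R A∼B (single x t))
         (≡⇒∼ (fsub-cong-≡f R (single-cong-≡t R x t≡u) B))
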